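{- Let ${\bf d}=(d_0,d_1,\ldots)$ be a directive sequence of integers with $d_i\ge 1$ for all $i\ge 0$, with standard words $s_{ -1}=b$, $s_0=a$, $s_{n+1}=s_n^{d_n}s_{n-1}$, lengths $q_n=|s_n|$, and characteristic word ${\bf w}={\bf w}[1]{\bf w}[2]\cdots=\lim_n s_n$. Let $0\le p_1\le p_2$ be integers such that ${\bf w}(p_1..p_2]$ is a palindrome. Then there exist valid representations $r_1$ of $p_1$ and $r_2$ of $p_2$ (written with a common number of digits, padding with leading zeros) such that $z_i(r_1)=z_i(r_2)$ for every index $i$ except at most one index $i=m$.
   Context: ${\bf w}(i..j]$ denotes ${\bf w}[i+1]\cdots{\bf w}[j]$. A valid representation of $N$ is a sequence of integers $x_n\cdots x_0$ with $x_i\ge 0$, $N=\sum_{i=0}^n x_iq_i$, and such that the prefix of length $N$ of ${\bf w}$ equals $s_n^{x_n}\cdots s_1^{x_1}s_0^{x_0}$. For a valid representation $r=x_n\cdots x_0$ and $m\in\{0,\ldots,n\}$, $z_m(r)=\min(x_m,|d_m-x_m|)$. -}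

module Defs where

open import Data.Nat using (ℕ; zero; suc; _+_; _*_; _∸_; ∣_-_∣; _⊓_)
open import Data.List using (List; []; _∷_; _++_; concat; replicate; map; upTo; length; reverse)
open import Data.Fin using (Fin; fromℕ; inject₁; toℕ)
open import Data.Product using (_×_; _,_; proj₁; proj₂)

data Letter : Set where
  a b : Letter

Word : Set
Word = List Letter

Directive : Set
Directive = ℕ → ℕ

-- stdPair d n = (s_{n-1}, s_n), with s_{-1} = b, s_0 = a,
-- s_{n+1} = s_n^{d_n} s_{n-1}.
stdPair : Directive → ℕ → Word × Word
stdPair d zero = (b ∷ [] , a ∷ [])
stdPair d (suc n) with stdPair d n
... | (prev , cur) = (cur , concat (replicate (d n) cur) ++ prev)

s : Directive → ℕ → Word
s d n = proj₂ (stdPair d n)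

q : Directive → ℕ → ℕ
q d n = length (s d n)

nthOr : Word → ℕ → Letter
nthOr [] k = a
nthOr (x ∷ xs) zero = x
nthOr (x ∷ xs) (suc k) = nthOr xs k

-- Characteristic word w = lim s_n, 0-based: w d k = 𝐰[k+1].
-- Since s_n is a prefix of s_{n+1} and |s_{k+1}| ≥ k+1 (when all d_i ≥ 1),
-- the (k+1)-th letter of w is the (k+1)-th letter of s_{k+1}.
w : Directive → ℕ → Letter
w d k = nthOr (s d (suc k)) k

-- 𝐰(i..j] = 𝐰[i+1] ⋯ 𝐰[j]
factor : Directive → ℕ → ℕ → Word
factor d i j = map (λ t → w d (i + t)) (upTo (j ∸ i))

prefix : Directive → ℕ → Word
prefix d N = map (w d) (upTo N)

IsPalindrome : Word → Set
IsPalindrome u = reverse u ≡ u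
  where open import Relation.Binary.PropositionalEquality using (_≡_)

-- A representation with n+1 digits x_n ⋯ x_0 is a function x : Fin (suc n) → ℕ,
-- x i being the digit x_i.

value : Directive → (n : ℕ) → (Fin (suc n) → ℕ) → ℕ
value d zero x = x (fromℕ zero) * q d zero
value d (suc n) x = x (fromℕ (suc n)) * q d (suc n) + value d n (λ i → x (inject₁ i))

repWord : Directive → (n : ℕ) → (Fin (suc n) → ℕ) → Word
repWord d zero x = concat (replicate (x (fromℕ zero)) (s d zero))
repWord d (suc n) x =
  concat (replicate (x (fromℕ (suc n))) (s d (suc n))) ++ repWord d n (λ i → x (inject₁ i))

open import Relation.Binary.PropositionalEquality using (_≡_)

ValidRep : Directive → (n : ℕ) → (Fin (suc n) → ℕ) → ℕ → Set
ValidRep d n x N = (value d n x ≡ N) × (prefix d N ≡ repWord d n x)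

z : Directive → (n : ℕ) → (Fin (suc n) → ℕ) → Fin (suc n) → ℕ
z d n x m = x m ⊓ ∣ d (toℕ m) - x m ∣

-- Let σ be the morphism a ↦ a^{d₀} b, b ↦ a and d′ = (d₁, d₂, …). Then s_{n+1}(d) = σ(s_n(d′)),
-- so 𝐰(d) = σ(𝐰(d′)) is a concatenation of blocks σ(𝐰′[t]), the t-th one starting at position
-- start t. If the palindrome 𝐰(p₁..p₂] contains no b, then p₁ and p₂ have representations
-- differing only in the last digit. Otherwise its first and last b cut it as p₁ = start T + e and
-- p₂ = start T₂ + f with e + f = d₀, and by the mirror symmetry 𝐰′(T..T₂] is again a palindrome.
-- Representations of T and T₂ for d′ extend by the last digits e and f, which have the same
-- z₀ = min(e, d₀ − e) = min(f, d₀ − f). Since T₂ < p₂, induction on p₂ proves the theorem.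
module Submission where

open import Defs
open import Data.Nat using (ℕ; zero; suc; _+_; _*_; _∸_; _≤_; _<_; z≤n; s≤s; _⊓_; ∣_-_∣; _<?_; _≤?_)
open import Data.Nat.Properties
open import Data.Nat.Induction using (<-rec)
open import Data.Nat.Tactic.RingSolver using (solve-∀)
open import Data.List using (List; []; _∷_; _++_; concat; replicate; map; upTo; length; reverse; applyUpTo; applyDownFrom)
open import Data.List.Properties using (length-++; length-replicate; ++-assoc; ++-identityʳ; length-map; length-upTo; map-upTo; applyUpTo-∷ʳ; reverse-applyUpTo)
open import Data.Vec.Functional using () renaming (_∷_ to _∷ᵈ_)
open import Data.Fin using (Fin; zero; suc; fromℕ; inject₁)
open import Data.Product using (Σ; ∃; _×_; _,_; proj₁; proj₂)
open import Data.Sum using (_⊎_; inj₁; inj₂)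
open import Data.Empty using (⊥-elim)
open import Relation.Nullary using (yes; no)
open import Relation.Binary.PropositionalEquality

a≢b : a ≢ b
a≢b ()

nthOr-++ˡ : ∀ (xs ys : Word) {k} → k < length xs → nthOr (xs ++ ys) k ≡ nthOr xs k
nthOr-++ˡ (x ∷ xs) ys {zero}  _        = refl
nthOr-++ˡ (x ∷ xs) ys {suc k} (s≤s k<) = nthOr-++ˡ xs ys k<

nthOr-++ʳ : ∀ (xs ys : Word) i → nthOr (xs ++ ys) (length xs + i) ≡ nthOr ys i
nthOr-++ʳ []       ys i = refl
nthOr-++ʳ (x ∷ xs) ys i = nthOr-++ʳ xs ys i

nthOr-replicate : ∀ n c {i} → i < n → nthOr (replicate n c) i ≡ c
nthOr-replicate (suc n) c {zero}  _        = refl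
nthOr-replicate (suc n) c {suc i} (s≤s i<) = nthOr-replicate n c i<

nthOr-replicate-++ˡ : ∀ n c (ys : Word) {i} → i < n → nthOr (replicate n c ++ ys) i ≡ c
nthOr-replicate-++ˡ (suc n) c ys {zero}  _        = refl
nthOr-replicate-++ˡ (suc n) c ys {suc i} (s≤s i<) = nthOr-replicate-++ˡ n c ys i<

nthOr-replicate-++ʳ : ∀ n c (ys : Word) → nthOr (replicate n c ++ ys) n ≡ nthOr ys 0
nthOr-replicate-++ʳ zero    c ys = refl
nthOr-replicate-++ʳ (suc n) c ys = nthOr-replicate-++ʳ n c ys

nthOr-applyUpTo : ∀ (f : ℕ → Letter) N {k} → k < N → nthOr (applyUpTo f N) k ≡ f k
nthOr-applyUpTo f (suc N) {zero}  _        = refl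
nthOr-applyUpTo f (suc N) {suc k} (s≤s k<) = nthOr-applyUpTo (λ i → f (suc i)) N k<

nthOr-applyDownFrom : ∀ (f : ℕ → Letter) N {k} → k < N → nthOr (applyDownFrom f N) k ≡ f (N ∸ suc k)
nthOr-applyDownFrom f (suc N) {zero}  _        = refl
nthOr-applyDownFrom f (suc N) {suc k} (s≤s k<) = nthOr-applyDownFrom f N k<

applyUpTo-nthOr : ∀ (f : ℕ → Letter) ys → (∀ {k} → k < length ys → f k ≡ nthOr ys k) →
                  applyUpTo f (length ys) ≡ ys
applyUpTo-nthOr f []       _ = refl
applyUpTo-nthOr f (y ∷ ys) h = cong₂ _∷_ (h (s≤s z≤n)) (applyUpTo-nthOr (λ k → f (suc k)) ys (λ k< → h (s≤s k<)))

applyUpTo-prefixOf : ∀ (f : ℕ → Letter) xs {t} → t ≤ length xs → (∀ {k} → k < t → f k ≡ nthOr xs k) →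
                     Σ Word λ R → xs ≡ applyUpTo f t ++ R
applyUpTo-prefixOf f xs       {zero}  _        _ = xs , refl
applyUpTo-prefixOf f (x ∷ xs) {suc t} (s≤s t≤) h with applyUpTo-prefixOf (λ k → f (suc k)) xs t≤ (λ k< → h (s≤s k<))
... | R , xs≡ = R , cong₂ _∷_ (sym (h (s≤s z≤n))) xs≡

map-upTo-nthOr : ∀ (f : ℕ → Letter) ys {N} → length ys ≡ N → (∀ {k} → k < N → f k ≡ nthOr ys k) →
                 map f (upTo N) ≡ ys
map-upTo-nthOr f ys refl h = trans (map-upTo f (length ys)) (applyUpTo-nthOr f ys h)

length-prefix : ∀ d N → length (prefix d N) ≡ N
length-prefix d N = trans (length-map (w d) (upTo N)) (length-upTo N)

prefix-suc : ∀ d t → prefix d (suc t) ≡ prefix d t ++ w d t ∷ []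
prefix-suc d t = begin
  map (w d) (upTo (suc t))         ≡⟨ map-upTo (w d) (suc t) ⟩
  applyUpTo (w d) (suc t)          ≡⟨ sym (applyUpTo-∷ʳ (w d) t) ⟩
  applyUpTo (w d) t ++ w d t ∷ []  ≡⟨ cong (_++ w d t ∷ []) (sym (map-upTo (w d) t)) ⟩
  prefix d t ++ w d t ∷ []         ∎
  where open ≡-Reasoning

σ : ℕ → Letter → Word
σ k a = replicate k a ++ b ∷ []
σ k b = a ∷ []

σ* : ℕ → Word → Word
σ* k []       = []
σ* k (x ∷ xs) = σ k x ++ σ* k xs

blockLen : ℕ → Letter → ℕ
blockLen k a = suc k
blockLen k b = 1

length-σ : ∀ k c → length (σ k c) ≡ blockLen k c
length-σ k a = trans (length-++ (replicate k a)) (trans (cong (_+ 1) (length-replicate k)) (+-comm k 1))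
length-σ k b = refl

σ*-++ : ∀ k xs ys → σ* k (xs ++ ys) ≡ σ* k xs ++ σ* k ys
σ*-++ k []       ys = refl
σ*-++ k (x ∷ xs) ys = trans (cong (σ k x ++_) (σ*-++ k xs ys)) (sym (++-assoc (σ k x) (σ* k xs) (σ* k ys)))

σ*-concat-replicate : ∀ k n xs → σ* k (concat (replicate n xs)) ≡ concat (replicate n (σ* k xs))
σ*-concat-replicate k zero    xs = refl
σ*-concat-replicate k (suc n) xs = trans (σ*-++ k xs _) (cong (σ* k xs ++_) (σ*-concat-replicate k n xs))

concat-replicate-[a] : ∀ n → concat (replicate n (a ∷ [])) ≡ replicate n a
concat-replicate-[a] zero    = refl
concat-replicate-[a] (suc n) = cong (a ∷_) (concat-replicate-[a] n)

length-concat-replicate : ∀ n (xs : Word) → length (concat (replicate n xs)) ≡ n * length xs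
length-concat-replicate zero    xs = refl
length-concat-replicate (suc n) xs = trans (length-++ xs) (cong (length xs +_) (length-concat-replicate n xs))

shift : Directive → Directive
shift d i = d (suc i)

stdPair-suc : ∀ d n → stdPair d (suc n) ≡ (s d n , concat (replicate (d n) (s d n)) ++ proj₁ (stdPair d n))
stdPair-suc d n with stdPair d n
... | _ , _ = refl

stdPair-σ* : ∀ d n → stdPair d (suc n) ≡ (σ* (d 0) (proj₁ (stdPair (shift d) n)) , σ* (d 0) (s (shift d) n))
stdPair-σ* d zero    = cong (a ∷ [] ,_) (trans (cong (_++ b ∷ []) (concat-replicate-[a] (d 0))) (sym (++-identityʳ _)))
stdPair-σ* d (suc n) = begin
    stdPair d (suc (suc n))
      ≡⟨ stdPair-suc d (suc n) ⟩
    (s d (suc n) , concat (replicate (d (suc n)) (s d (suc n))) ++ proj₁ (stdPair d (suc n)))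
      ≡⟨ cong (λ X → (proj₂ X , concat (replicate (d (suc n)) (proj₂ X)) ++ proj₁ X)) (stdPair-σ* d n) ⟩
    (σ* D cur , concat (replicate (d (suc n)) (σ* D cur)) ++ σ* D prev)
      ≡⟨ cong (σ* D cur ,_) (sym σ*-step) ⟩
    (σ* D cur , σ* D (concat (replicate (d (suc n)) cur) ++ prev))
      ≡⟨ cong (λ X → (σ* D (proj₁ X) , σ* D (proj₂ X))) (sym (stdPair-suc (shift d) n)) ⟩
    (σ* D (proj₁ (stdPair (shift d) (suc n))) , σ* D (s (shift d) (suc n))) ∎
  where
    open ≡-Reasoning
    D = d 0
    prev = proj₁ (stdPair (shift d) n)
    cur = s (shift d) n
    σ*-step : σ* D (concat (replicate (d (suc n)) cur) ++ prev) ≡ concat (replicate (d (suc n)) (σ* D cur)) ++ σ* D prev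
    σ*-step = trans (σ*-++ D (concat (replicate (d (suc n)) cur)) prev) (cong (_++ σ* D prev) (σ*-concat-replicate D (d (suc n)) cur))

s-suc : ∀ d n → s d (suc n) ≡ σ* (d 0) (s (shift d) n)
s-suc d n = cong proj₂ (stdPair-σ* d n)

Positive : Directive → Set
Positive d = ∀ i → 1 ≤ d i

stdPair-nonempty : ∀ d n → 1 ≤ length (proj₁ (stdPair d n))
s-nonempty : ∀ d n → 1 ≤ q d n

stdPair-nonempty d zero    = s≤s z≤n
stdPair-nonempty d (suc n) = subst (λ X → 1 ≤ length (proj₁ X)) (sym (stdPair-suc d n)) (s-nonempty d n)

s-nonempty d zero    = s≤s z≤n
s-nonempty d (suc n) = subst (λ X → 1 ≤ length (proj₂ X)) (sym (stdPair-suc d n))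
  (subst (1 ≤_) (sym (length-++ (concat (replicate (d n) (s d n))))) (≤-trans (stdPair-nonempty d n) (m≤n+m _ _)))

s-step : ∀ d → Positive d → ∀ n → Σ Word λ R → (s d (suc n) ≡ s d n ++ R) × (1 ≤ length R)
s-step d pos n with d n | pos n | stdPair-suc d n
... | suc k | _ | eq = concat (replicate k (s d n)) ++ proj₁ (stdPair d n)
                     , trans (cong proj₂ eq) (++-assoc (s d n) _ _)
                     , subst (1 ≤_) (sym (length-++ (concat (replicate k (s d n))))) (≤-trans (stdPair-nonempty d n) (m≤n+m _ _))

s-prefixOf-s : ∀ d → Positive d → ∀ {n m} → n ≤ m → Σ Word λ R → s d m ≡ s d n ++ R
s-prefixOf-s d pos {n} n≤m with m≤n⇒∃[o]m+o≡n n≤m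
... | k , refl = go k
  where
    go : ∀ k → Σ Word λ R → s d (n + k) ≡ s d n ++ R
    go zero    = [] , trans (cong (s d) (+-identityʳ n)) (sym (++-identityʳ (s d n)))
    go (suc k) with go k | s-step d pos (n + k)
    ... | R , s≡ | R′ , s≡′ , _ = R ++ R′ ,
      trans (cong (s d) (+-suc n k)) (trans s≡′ (trans (cong (_++ R′) s≡) (++-assoc (s d n) R R′)))

n<q : ∀ d → Positive d → ∀ n → n < q d n
n<q d pos zero    = s≤s z≤n
n<q d pos (suc n) with s-step d pos n
... | R , s≡ , R≢[] = subst (suc n <_) (sym (trans (cong length s≡) (length-++ (s d n))))
                            (subst (_≤ q d n + length R) (+-comm (suc n) 1) (+-mono-≤ (n<q d pos n) R≢[]))

w≡nthOr-s : ∀ d → Positive d → ∀ n {k} → k < q d n → w d k ≡ nthOr (s d n) k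
w≡nthOr-s d pos n {k} k< with ≤-total (suc k) n
... | inj₁ k<n = letter-stable (suc k) n k<n (<-trans (n<1+n k) (n<q d pos (suc k)))
  where
    letter-stable : ∀ n m → n ≤ m → k < q d n → nthOr (s d n) k ≡ nthOr (s d m) k
    letter-stable n m n≤m k<qn with s-prefixOf-s d pos n≤m
    ... | R , s≡ = trans (sym (nthOr-++ˡ (s d n) R k<qn)) (cong (λ u → nthOr u k) (sym s≡))
... | inj₂ n≤k with s-prefixOf-s d pos n≤k
... | R , s≡ = trans (cong (λ u → nthOr u k) s≡) (nthOr-++ˡ (s d n) R k<)

prefix-prefixOf-s : ∀ d → Positive d → ∀ t → Σ Word λ R → s d t ≡ prefix d t ++ R
prefix-prefixOf-s d pos t with applyUpTo-prefixOf (w d) (s d t) (<⇒≤ (n<q d pos t))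
                                 (λ k< → w≡nthOr-s d pos t (<-trans k< (n<q d pos t)))
... | R , s≡ = R , trans s≡ (cong (_++ R) (sym (map-upTo (w d) t)))

w-zero : ∀ d → Positive d → w d 0 ≡ a
w-zero d pos with d 0 | pos 0
... | suc _ | _ = refl

PalindromeAt : (ℕ → Letter) → ℕ → ℕ → Set
PalindromeAt W p L = ∀ u v → suc (u + v) ≡ L → W (p + u) ≡ W (p + v)

factor-palindromeAt : ∀ d p₁ p₂ → IsPalindrome (factor d p₁ p₂) → PalindromeAt (w d) p₁ (p₂ ∸ p₁)
factor-palindromeAt d p₁ p₂ pal u v uv = begin
    f u                                  ≡⟨ sym (nthOr-applyUpTo f L u<) ⟩
    nthOr (applyUpTo f L) u              ≡⟨ cong (λ ys → nthOr ys u) (sym pal′) ⟩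
    nthOr (reverse (applyUpTo f L)) u    ≡⟨ cong (λ ys → nthOr ys u) (reverse-applyUpTo f L) ⟩
    nthOr (applyDownFrom f L) u          ≡⟨ nthOr-applyDownFrom f L u< ⟩
    f (L ∸ suc u)                        ≡⟨ cong (λ n → f (n ∸ suc u)) (sym uv) ⟩
    f (u + v ∸ u)                        ≡⟨ cong f (m+n∸m≡n u v) ⟩
    f v                                  ∎
  where
    open ≡-Reasoning
    L = p₂ ∸ p₁
    f = λ t → w d (p₁ + t)
    pal′ : IsPalindrome (applyUpTo f L)
    pal′ = subst IsPalindrome (map-upTo f L) pal
    u< : u < L
    u< = subst (u <_) uv (s≤s (m≤m+n u v))

palindromeAt-suffix-a : ∀ {W : ℕ → Letter} {p L y f j} → PalindromeAt W p L → f ≤ j → j < L →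
                        (∀ k → k < j → W (p + k) ≡ a) → y + f ≡ p + L → ∀ i → i < f → W (y + i) ≡ a
palindromeAt-suffix-a {W} {p} {L} {y} {f} {j} pal f≤j j<L before yf i i<f with m≤n⇒∃[o]m+o≡n i<f
... | g , ig with m≤n⇒∃[o]m+o≡n (<-≤-trans (subst (g <_) ig (m<n+m g (s≤s z≤n))) (≤-trans f≤j (<⇒≤ j<L)))
... | u , gu = trans (cong W y+i≡p+u) (trans (pal u g (trans (cong suc (+-comm u g)) gu)) (before g g<j))
  where
    open ≡-Reasoning
    g<j : g < j
    g<j = <-≤-trans (subst (g <_) ig (m<n+m g (s≤s z≤n))) f≤j
    y+i≡p+u : y + i ≡ p + u
    y+i≡p+u = +-cancelʳ-≡ (suc g) _ _ (begin
      y + i + suc g     ≡⟨ shuffle₁ y i g ⟩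
      y + suc (i + g)   ≡⟨ cong (y +_) ig ⟩
      y + f             ≡⟨ yf ⟩
      p + L             ≡⟨ cong (p +_) (sym gu) ⟩
      p + suc (g + u)   ≡⟨ shuffle₂ p g u ⟩
      p + u + suc g     ∎)
      where
        shuffle₁ : ∀ y i g → y + i + suc g ≡ y + suc (i + g)
        shuffle₁ = solve-∀
        shuffle₂ : ∀ p g u → p + suc (g + u) ≡ p + u + suc g
        shuffle₂ = solve-∀

allA-or-firstB : ∀ (W : ℕ → Letter) p L → (∀ k → k < L → W (p + k) ≡ a) ⊎
                 ∃ λ j → j < L × W (p + j) ≡ b × (∀ k → k < j → W (p + k) ≡ a)
allA-or-firstB W p zero = inj₁ (λ k ())
allA-or-firstB W p (suc L) with allA-or-firstB W p L
... | inj₂ (j , j<L , wb , before) = inj₂ (j , m≤n⇒m≤1+n j<L , wb , before)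
... | inj₁ allA with W (p + L) in wL
...   | b = inj₂ (L , n<1+n L , wL , allA)
...   | a = inj₁ λ k k< → extend k (m≤n⇒m<n∨m≡n (≤-pred k<))
  where
    extend : ∀ k → k < L ⊎ k ≡ L → W (p + k) ≡ a
    extend k (inj₁ k<L) = allA k k<L
    extend k (inj₂ refl) = wL

z-complement : ∀ D e f → e + f ≡ D → e ⊓ ∣ D - e ∣ ≡ f ⊓ ∣ D - f ∣
z-complement D e f refl = trans (cong (e ⊓_) ∣e+f-e∣) (trans (⊓-comm e f) (cong (f ⊓_) (sym ∣e+f-f∣)))
  where
    ∣e+f-e∣ : ∣ e + f - e ∣ ≡ f
    ∣e+f-e∣ = trans (m≤n⇒∣n-m∣≡n∸m (m≤m+n e f)) (m+n∸m≡n e f)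
    ∣e+f-f∣ : ∣ e + f - f ∣ ≡ e
    ∣e+f-f∣ = trans (m≤n⇒∣n-m∣≡n∸m (m≤n+m f e)) (m+n∸n≡m e f)

record Spells (d : Directive) (n : ℕ) (r : Fin (suc n) → ℕ) (N : ℕ) : Set where
  constructor spells
  field prefix≡repWord : prefix d N ≡ repWord d n r

value-length : ∀ d n r → value d n r ≡ length (repWord d n r)
value-length d zero    r = sym (length-concat-replicate (r zero) (s d 0))
value-length d (suc n) r = trans (cong₂ _+_ (sym (length-concat-replicate (r (fromℕ (suc n))) (s d (suc n))))
                                          (value-length d n (λ i → r (inject₁ i))))
                                 (sym (length-++ (concat (replicate (r (fromℕ (suc n))) (s d (suc n))))))

spells⇒validRep : ∀ d n r N → Spells d n r N → ValidRep d n r N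
spells⇒validRep d n r N (spells sp) = trans (value-length d n r) (trans (cong length (sym sp)) (length-prefix d N)) , sp

repWord-cong : ∀ d n {f g : Fin (suc n) → ℕ} → (∀ i → f i ≡ g i) → repWord d n f ≡ repWord d n g
repWord-cong d zero    f≗g = cong (λ k → concat (replicate k (s d 0))) (f≗g zero)
repWord-cong d (suc n) f≗g = cong₂ _++_ (cong (λ k → concat (replicate k (s d (suc n)))) (f≗g (fromℕ (suc n))))
                                        (repWord-cong d n (λ i → f≗g (inject₁ i)))

repWord-∷ : ∀ d n x (r : Fin (suc n) → ℕ) → repWord d (suc n) (x ∷ᵈ r) ≡ σ* (d 0) (repWord (shift d) n r) ++ replicate x a
repWord-∷ d zero    x r = cong₂ _++_
  (trans (cong (λ u → concat (replicate (r zero) u)) (s-suc d 0)) (sym (σ*-concat-replicate (d 0) (r zero) (s (shift d) 0))))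
  (concat-replicate-[a] x)
repWord-∷ d (suc n) x r = begin
    concat (replicate k (s d (suc (suc n)))) ++ repWord d (suc n) (λ i → (x ∷ᵈ r) (inject₁ i))
      ≡⟨ cong₂ _++_ top (repWord-cong d (suc n) inject₁-∷) ⟩
    σ* D C ++ repWord d (suc n) (x ∷ᵈ (λ i → r (inject₁ i)))
      ≡⟨ cong (σ* D C ++_) (repWord-∷ d n x (λ i → r (inject₁ i))) ⟩
    σ* D C ++ (σ* D B ++ replicate x a)
      ≡⟨ sym (++-assoc (σ* D C) (σ* D B) _) ⟩
    (σ* D C ++ σ* D B) ++ replicate x a
      ≡⟨ cong (_++ replicate x a) (sym (σ*-++ D C B)) ⟩
    σ* D (C ++ B) ++ replicate x a ∎
  where
    open ≡-Reasoning
    D = d 0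
    k = r (fromℕ (suc n))
    C = concat (replicate k (s (shift d) (suc n)))
    B = repWord (shift d) n (λ i → r (inject₁ i))
    top : concat (replicate k (s d (suc (suc n)))) ≡ σ* D C
    top = trans (cong (λ u → concat (replicate k u)) (s-suc d (suc n))) (sym (σ*-concat-replicate D k _))
    inject₁-∷ : ∀ i → (x ∷ᵈ r) (inject₁ i) ≡ (x ∷ᵈ (λ i → r (inject₁ i))) i
    inject₁-∷ zero    = refl
    inject₁-∷ (suc i) = refl

PalindromicReps : Directive → ℕ → ℕ → Set
PalindromicReps d p₁ p₂ = Σ ℕ λ n → Σ (Fin (suc n) → ℕ) λ r₁ → Σ (Fin (suc n) → ℕ) λ r₂ →
  Spells d n r₁ p₁ × Spells d n r₂ p₂ ×
  ∃ λ (m : Fin (suc n)) → ∀ (i : Fin (suc n)) → i ≢ m → z d n r₁ i ≡ z d n r₂ i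

module Blocks (d : Directive) (pos : Positive d) where

  d′ : Directive
  d′ = shift d

  pos′ : Positive d′
  pos′ i = pos (suc i)

  D : ℕ
  D = d 0

  W W′ : ℕ → Letter
  W  = w d
  W′ = w d′

  start : ℕ → ℕ
  start t = length (σ* D (prefix d′ t))

  σ*-prefix-suc : ∀ t → σ* D (prefix d′ (suc t)) ≡ σ* D (prefix d′ t) ++ σ D (W′ t)
  σ*-prefix-suc t = trans (cong (σ* D) (prefix-suc d′ t))
    (trans (σ*-++ D (prefix d′ t) (W′ t ∷ [])) (cong (σ* D (prefix d′ t) ++_) (++-identityʳ _)))

  start-suc : ∀ t → start (suc t) ≡ start t + blockLen D (W′ t)
  start-suc t = trans (cong length (σ*-prefix-suc t))
    (trans (length-++ (σ* D (prefix d′ t))) (cong (start t +_) (length-σ D (W′ t))))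

  w-σ*-prefix : ∀ t {k} → k < start t → W k ≡ nthOr (σ* D (prefix d′ t)) k
  w-σ*-prefix t {k} k< with prefix-prefixOf-s d′ pos′ t
  ... | R , s≡ = begin
      W k                                      ≡⟨ w≡nthOr-s d pos (suc t) k<q ⟩
      nthOr (s d (suc t)) k                    ≡⟨ cong (λ u → nthOr u k) s≡′ ⟩
      nthOr (σ* D (prefix d′ t) ++ σ* D R) k   ≡⟨ nthOr-++ˡ (σ* D (prefix d′ t)) (σ* D R) k< ⟩
      nthOr (σ* D (prefix d′ t)) k             ∎
    where
      open ≡-Reasoning
      s≡′ : s d (suc t) ≡ σ* D (prefix d′ t) ++ σ* D R
      s≡′ = trans (s-suc d t) (trans (cong (σ* D) s≡) (σ*-++ D (prefix d′ t) R))
      k<q : k < q d (suc t)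
      k<q = <-≤-trans k< (subst (start t ≤_) (sym (trans (cong length s≡′) (length-++ (σ* D (prefix d′ t))))) (m≤m+n _ _))

  w-block : ∀ t {i} → i < blockLen D (W′ t) → W (start t + i) ≡ nthOr (σ D (W′ t)) i
  w-block t {i} i< = begin
      W (start t + i)                                       ≡⟨ w-σ*-prefix (suc t) i<start ⟩
      nthOr (σ* D (prefix d′ (suc t))) (start t + i)        ≡⟨ cong (λ u → nthOr u (start t + i)) (σ*-prefix-suc t) ⟩
      nthOr (σ* D (prefix d′ t) ++ σ D (W′ t)) (start t + i) ≡⟨ nthOr-++ʳ (σ* D (prefix d′ t)) _ i ⟩
      nthOr (σ D (W′ t)) i                                  ∎
    where
      open ≡-Reasoning
      i<start : start t + i < start (suc t)
      i<start = subst (start t + i <_) (sym (start-suc t)) (+-monoʳ-< (start t) i<)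

  w-block-at : ∀ t {c i} → W′ t ≡ c → i < blockLen D c → W (start t + i) ≡ nthOr (σ D c) i
  w-block-at t refl = w-block t

  w-aBlock-a : ∀ {t i} → W′ t ≡ a → i < D → W (start t + i) ≡ a
  w-aBlock-a {t} wa i<D = trans (w-block-at t wa (m≤n⇒m≤1+n i<D)) (nthOr-replicate-++ˡ D a _ i<D)

  w-aBlock-b : ∀ {t} → W′ t ≡ a → W (start t + D) ≡ b
  w-aBlock-b {t} wa = trans (w-block-at t wa ≤-refl) (nthOr-replicate-++ʳ D a _)

  w-bBlock : ∀ {t} → W′ t ≡ b → W (start t) ≡ a
  w-bBlock {t} wb = trans (cong W (sym (+-identityʳ (start t)))) (w-block-at t wb (s≤s z≤n))

  w-start : ∀ t → W (start t) ≡ a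
  w-start t with W′ t in wt
  ... | a = trans (cong W (sym (+-identityʳ (start t)))) (w-aBlock-a wt (pos 0))
  ... | b = w-bBlock wt

  w-block-prefix-a : ∀ t {x} → x < blockLen D (W′ t) → ∀ i → i < x → W (start t + i) ≡ a
  w-block-prefix-a t x< i i<x with W′ t in wt
  w-block-prefix-a t x<        i i<x | a = w-aBlock-a wt (<-≤-trans i<x (≤-pred x<))
  w-block-prefix-a t (s≤s z≤n) i ()  | b

  <-blockLen-a : ∀ {t i} → W′ t ≡ a → i ≤ D → i < blockLen D (W′ t)
  <-blockLen-a wa i≤D = subst (λ c → _ < blockLen D c) (sym wa) (s≤s i≤D)

  blockLen-pos : ∀ c → 0 < blockLen D c
  blockLen-pos a = s≤s z≤n
  blockLen-pos b = s≤s z≤n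

  start-suc-a : ∀ {t} → W′ t ≡ a → start (suc t) ≡ start t + suc D
  start-suc-a {t} wa = trans (start-suc t) (cong (λ c → start t + blockLen D c) wa)

  start-suc-b : ∀ {t} → W′ t ≡ b → start (suc t) ≡ start t + 1
  start-suc-b {t} wb = trans (start-suc t) (cong (λ c → start t + blockLen D c) wb)

  start-<-suc : ∀ t → start t < start (suc t)
  start-<-suc t = subst (start t <_) (sym (start-suc t)) (m<m+n (start t) (blockLen-pos (W′ t)))

  start-mono-≤ : ∀ {t t′} → t ≤ t′ → start t ≤ start t′
  start-mono-≤ {t} t≤t′ with m≤n⇒∃[o]m+o≡n t≤t′
  ... | k , refl = go k
    where
      go : ∀ k → start t ≤ start (t + k)
      go zero    = ≤-reflexive (cong start (sym (+-identityʳ t)))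
      go (suc k) = ≤-trans (go k) (subst (λ t′ → start (t + k) ≤ start t′) (sym (+-suc t k)) (<⇒≤ (start-<-suc (t + k))))

  start-mono-< : ∀ {t t′} → t < t′ → start t < start t′
  start-mono-< {t} t<t′ = <-≤-trans (start-<-suc t) (start-mono-≤ t<t′)

  start-cancel-< : ∀ {t t′} → start t < start t′ → t < t′
  start-cancel-< lt = ≰⇒> (λ t′≤t → <⇒≱ lt (start-mono-≤ t′≤t))

  start-cancel-≤ : ∀ {t t′} → start t ≤ start t′ → t ≤ t′
  start-cancel-≤ le = ≮⇒≥ (λ t′<t → ≤⇒≯ le (start-mono-< t′<t))

  start-grow : ∀ t → suc t < start (suc t)
  start-grow t = ≤-trans (subst (_≤ t + suc D) (+-comm t 2) (+-monoʳ-≤ t (s≤s (pos 0)))) (go t)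
    where
      go : ∀ t → t + suc D ≤ start (suc t)
      go zero    = ≤-reflexive (sym (start-suc-a (w-zero d′ pos′)))
      go (suc t) = ≤-trans (s≤s (go t)) (start-<-suc (suc t))

  decompose : ∀ p → Σ ℕ λ t → Σ ℕ λ x → (start t + x ≡ p) × (x < blockLen D (W′ t))
  decompose zero = 0 , 0 , refl , blockLen-pos (W′ 0)
  decompose (suc p) with decompose p
  ... | t , x , tx≡p , x< with m≤n⇒m<n∨m≡n x<
  ... | inj₁ sx< = t , suc x , trans (+-suc (start t) x) (cong suc tx≡p) , sx<
  ... | inj₂ sx≡ = suc t , 0 , trans (+-identityʳ _) (trans (start-suc t)
                     (trans (cong (start t +_) (sym sx≡)) (trans (+-suc (start t) x) (cong suc tx≡p)))) , blockLen-pos _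

  b-position : ∀ {p} → W p ≡ b → Σ ℕ λ t → (W′ t ≡ a) × (start t + D ≡ p)
  b-position {p} wb with decompose p
  ... | t , x , refl , x< with W′ t in wt
  ... | b = ⊥-elim (a≢b (trans (sym (w-bBlock wt)) (trans (cong W start≡) wb)))
    where
      start≡ : start t ≡ start t + x
      start≡ = sym (trans (cong (start t +_) (n<1⇒n≡0 x<)) (+-identityʳ _))
  ... | a with m≤n⇒m<n∨m≡n (≤-pred x<)
  ...   | inj₁ x<D  = ⊥-elim (a≢b (trans (sym (w-aBlock-a wt x<D)) wb))
  ...   | inj₂ refl = t , wt , refl

  aRun-start : ∀ {p} → (∀ k → k ≤ D → W (p + k) ≡ a) → Σ ℕ λ t → (W′ t ≡ b) × (start t ≡ p)
  aRun-start {p} run with decompose p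
  ... | t , x , tx≡p , x< with W′ t in wt
  ... | a = ⊥-elim (a≢b (trans (sym (run (D ∸ x) (m∸n≤m D x))) (trans (cong W p+≡) (w-aBlock-b wt))))
    where
      p+≡ : p + (D ∸ x) ≡ start t + D
      p+≡ = trans (cong (_+ (D ∸ x)) (sym tx≡p))
              (trans (+-assoc (start t) x (D ∸ x)) (cong (start t +_) (m+[n∸m]≡n (≤-pred x<))))
  ... | b = t , wt , trans (sym (+-identityʳ (start t))) (trans (cong (start t +_) (sym (n<1⇒n≡0 x<))) tx≡p)

  no-bb : ∀ {k} → W k ≡ b → W (suc k) ≡ a
  no-bb wb with b-position wb
  ... | t , wa , refl = subst (λ i → W i ≡ a) (trans (start-suc-a wa) (+-suc (start t) D)) (w-start (suc t))

  w-aBlock-last : ∀ {t B} → W′ t ≡ a → suc B ≡ start (suc t) → W B ≡ b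
  w-aBlock-last {t} wa last = subst (λ i → W i ≡ b)
    (suc-injective (trans (sym (+-suc (start t) D)) (trans (sym (start-suc-a wa)) (sym last)))) (w-aBlock-b wa)

  w-bBlock-last : ∀ {t B} → W′ t ≡ b → suc B ≡ start (suc t) → W B ≡ a
  w-bBlock-last {t} wb last = subst (λ i → W i ≡ a)
    (suc-injective (trans (+-comm 1 (start t)) (trans (sym (start-suc-b wb)) (sym last)))) (w-bBlock wb)

  spells-lift : ∀ {n r t x} → Spells d′ n r t → (∀ i → i < x → W (start t + i) ≡ a) →
                Spells d (suc n) (x ∷ᵈ r) (start t + x)
  spells-lift {n} {r} {t} {x} (spells sp) run = spells (begin
      prefix d (start t + x)                    ≡⟨ map-upTo-nthOr W _ length≡ letters ⟩
      σ* D (prefix d′ t) ++ replicate x a       ≡⟨ cong (λ u → σ* D u ++ replicate x a) sp ⟩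
      σ* D (repWord d′ n r) ++ replicate x a    ≡⟨ sym (repWord-∷ d n x r) ⟩
      repWord d (suc n) (x ∷ᵈ r)                ∎)
    where
      open ≡-Reasoning
      length≡ : length (σ* D (prefix d′ t) ++ replicate x a) ≡ start t + x
      length≡ = trans (length-++ (σ* D (prefix d′ t))) (cong (start t +_) (length-replicate x))
      letters : ∀ {k} → k < start t + x → W k ≡ nthOr (σ* D (prefix d′ t) ++ replicate x a) k
      letters {k} k< with k <? start t
      ... | yes k<start = trans (w-σ*-prefix t k<start) (sym (nthOr-++ˡ (σ* D (prefix d′ t)) _ k<start))
      ... | no k≮start with m≤n⇒∃[o]m+o≡n (≮⇒≥ k≮start)
      ... | i , refl = trans (run i i<x) (sym (trans (nthOr-++ʳ (σ* D (prefix d′ t)) _ i) (nthOr-replicate x a i<x)))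
        where
          i<x : i < x
          i<x = +-cancelˡ-< (start t) i x k<

module Desubstitution (d : Directive) (pos : Positive d) where

  open Blocks d pos public

  private
    next-a : ∀ {t} → W′ t ≡ b → W′ (suc t) ≡ a
    next-a = Blocks.no-bb d′ pos′

  -- A b of 𝐰′ is followed by an a, so its block is followed by at least d₀ letters a.
  w-bBlock-next : ∀ {t} → W′ t ≡ b → W (start t + D) ≡ a
  w-bBlock-next {t} wb with m≤n⇒∃[o]m+o≡n (pos 0)
  ... | D₀ , sD₀≡D = subst (λ i → W i ≡ a) start≡ (w-aBlock-a (next-a wb) (subst (D₀ <_) sD₀≡D ≤-refl))
    where
      start≡ : start (suc t) + D₀ ≡ start t + D
      start≡ = trans (cong (_+ D₀) (start-suc-b wb)) (trans (+-assoc (start t) 1 D₀) (cong (start t +_) sD₀≡D))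

  w-bBlock-run-end : ∀ {t} → W′ t ≡ b → W (start t + suc D) ≡ b
  w-bBlock-run-end {t} wb = subst (λ i → W i ≡ b)
    (trans (cong (_+ D) (start-suc-b wb)) (+-assoc (start t) 1 D)) (w-aBlock-b (next-a wb))

  -- The letter at offset d₀ of a block and the last letter of a block each determine the letter of 𝐰′.
  letter-from-ends : ∀ {t t′ B} → W (start t + D) ≡ W B → suc B ≡ start (suc t′) → W′ t ≡ W′ t′
  letter-from-ends {t} {t′} same last with W′ t in wt | W′ t′ in wt′
  ... | a | a = refl
  ... | b | b = refl
  ... | a | b = ⊥-elim (a≢b (trans (sym (w-bBlock-last wt′ last)) (trans (sym same) (w-aBlock-b wt))))
  ... | b | a = ⊥-elim (a≢b (trans (sym (w-bBlock-next wt)) (trans same (w-aBlock-last wt′ last))))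

  mirror-letters : ∀ {p L t t′} → PalindromeAt W p L → p ≤ start t + D → p < start (suc t′) →
                   start t + D + start (suc t′) ≡ p + (p + L) → W′ t ≡ W′ t′
  mirror-letters {p} {L} {t} {t′} pal p≤ p< sum with m≤n⇒∃[o]m+o≡n p≤ | m≤n⇒∃[o]m+o≡n p<
  ... | u , pu | v , pv = letter-from-ends (trans (cong W (sym pu)) (pal u v uv)) pv
    where
      rearrange : ∀ p u v → p + (p + suc (u + v)) ≡ p + u + suc (p + v)
      rearrange = solve-∀
      uv : suc (u + v) ≡ L
      uv = +-cancelˡ-≡ p _ _ (+-cancelˡ-≡ p _ _ (trans (rearrange p u v) (trans (cong₂ _+_ pu pv) sum)))

  -- The sums start (T + k) + start (T + k′) over k + k′ = M are constant, which keeps the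
  -- offset-d₀ letter of block T + k mirrored onto the last letter of block T + k′.
  palindrome-desubstitute : ∀ {p L T M e f} → e + f ≡ D → e < blockLen D (W′ T) → PalindromeAt W p L →
                            start T + e ≡ p → start (T + M) + f ≡ p + L → PalindromeAt W′ T M
  palindrome-desubstitute {p} {L} {T} {M} {e} {f} ef e< pal eqL eqR u v uv =
      letters u v (invariant u (suc v) (trans (+-suc u v) uv))
    where
      open ≡-Reasoning
      S : ℕ → ℕ
      S k = start (T + k)

      start-T+suc : ∀ k → S (suc k) ≡ start (suc (T + k))
      start-T+suc k = cong start (+-suc T k)

      letters : ∀ k k′ → S k + S (suc k′) ≡ start T + S M → W′ (T + k) ≡ W′ (T + k′)
      letters k k′ inv = mirror-letters pal p≤ p< sum
        where
          p≤ : p ≤ S k + D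
          p≤ = subst (_≤ S k + D) eqL (+-mono-≤ (start-mono-≤ (m≤m+n T k)) (subst (e ≤_) ef (m≤m+n e f)))
          p< : p < start (suc (T + k′))
          p< = subst (_< start (suc (T + k′))) eqL
                 (<-≤-trans (subst (start T + e <_) (sym (start-suc T)) (+-monoʳ-< (start T) e<))
                            (start-mono-≤ (s≤s (m≤m+n T k′))))
          swap : ∀ x y z → x + y + z ≡ (x + z) + y
          swap = solve-∀
          interchange : ∀ x y z v → (x + y) + (z + v) ≡ (x + z) + (y + v)
          interchange = solve-∀
          sum : S k + D + start (suc (T + k′)) ≡ p + (p + L)
          sum = begin
            S k + D + start (suc (T + k′))  ≡⟨ cong (S k + D +_) (sym (start-T+suc k′)) ⟩
            S k + D + S (suc k′)            ≡⟨ swap (S k) D (S (suc k′)) ⟩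
            (S k + S (suc k′)) + D          ≡⟨ cong₂ _+_ inv (sym ef) ⟩
            (start T + S M) + (e + f)       ≡⟨ interchange (start T) (S M) e f ⟩
            (start T + e) + (S M + f)       ≡⟨ cong₂ _+_ eqL eqR ⟩
            p + (p + L)                     ∎

      invariant : ∀ k k′ → k + k′ ≡ M → S k + S k′ ≡ start T + S M
      invariant zero    k′ refl = cong (λ t → start t + S k′) (+-identityʳ T)
      invariant (suc k) k′ kk′ = begin
          S (suc k) + S k′                          ≡⟨ cong (_+ S k′) (trans (start-T+suc k) (start-suc (T + k))) ⟩
          S k + blockLen D (W′ (T + k)) + S k′      ≡⟨ cong (λ c → S k + blockLen D c + S k′) (letters k k′ ih) ⟩
          S k + blockLen D (W′ (T + k′)) + S k′     ≡⟨ rotate (S k) _ (S k′) ⟩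
          S k + (S k′ + blockLen D (W′ (T + k′)))   ≡⟨ cong (S k +_) (sym (trans (start-T+suc k′) (start-suc (T + k′)))) ⟩
          S k + S (suc k′)                          ≡⟨ ih ⟩
          start T + S M                             ∎
        where
          ih : S k + S (suc k′) ≡ start T + S M
          ih = invariant k (suc k′) (trans (+-suc k k′) kk′)
          rotate : ∀ x y z → x + y + z ≡ x + (z + y)
          rotate = solve-∀

module Step (d : Directive) (pos : Positive d) {p L : ℕ} (pal : PalindromeAt (w d) p L)
  (ih : ∀ {T M} → T + M < p + L → PalindromeAt (w (shift d)) T M → PalindromicReps (shift d) T (T + M)) where

  open Desubstitution d pos

  -- Representations of t itself are the case of the empty palindrome at t.
  spelling : ∀ t → start t ≤ p + L → Σ ℕ λ n → Σ (Fin (suc n) → ℕ) λ r → Spells d′ n r t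
  spelling zero    _  = 0 , (λ _ → 0) , spells refl
  spelling (suc t) le with ih {suc t} {0} (subst (_< p + L) (sym (+-identityʳ (suc t))) (<-≤-trans (start-grow t) le)) (λ _ _ ())
  ... | n , r , _ , sp , _ = n , r , sp

  reps-allA : (∀ k → k < L → W (p + k) ≡ a) → PalindromicReps d p (p + L)
  reps-allA allA with decompose p
  ... | t , x , tx≡p , x< with spelling t (≤-trans (subst (start t ≤_) tx≡p (m≤m+n (start t) x)) (m≤m+n p L))
  ... | n , r , sp = suc n , x ∷ᵈ r , (x + L) ∷ᵈ r
      , subst (Spells d (suc n) (x ∷ᵈ r)) tx≡p (spells-lift sp (w-block-prefix-a t x<))
      , subst (Spells d (suc n) ((x + L) ∷ᵈ r)) (trans (sym (+-assoc (start t) x L)) (cong (_+ L) tx≡p)) (spells-lift sp run)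
      , zero , λ { zero ne → ⊥-elim (ne refl) ; (suc i) _ → refl }
    where
      run : ∀ i → i < x + L → W (start t + i) ≡ a
      run i i< with i <? x
      ... | yes i<x = w-block-prefix-a t x< i i<x
      ... | no i≮x with m≤n⇒∃[o]m+o≡n (≮⇒≥ i≮x)
      ...   | k , refl = trans (cong W (trans (sym (+-assoc (start t) x k)) (cong (_+ k) tx≡p))) (allA k (+-cancelˡ-< x k L i<))

  reps-via-blocks : ∀ {T T₂ e f} → T ≤ suc T₂ → e + f ≡ D → e < blockLen D (W′ T) →
                    start T + e ≡ p → start (suc T₂) + f ≡ p + L → (∀ i → i < f → W (start (suc T₂) + i) ≡ a) →
                    PalindromicReps d p (p + L)
  reps-via-blocks {T} {T₂} {e} {f} T≤ ef e< eqL eqR tail with m≤n⇒∃[o]m+o≡n T≤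
  ... | M , TM with ih (subst (_< p + L) (sym TM) (<-≤-trans (start-grow T₂) (subst (start (suc T₂) ≤_) eqR (m≤m+n _ f))))
                       (palindrome-desubstitute ef e< pal eqL (subst (λ t → start t + f ≡ p + L) (sym TM) eqR))
  ... | n , r₁ , r₂ , sp₁ , sp₂ , m , zs = suc n , e ∷ᵈ r₁ , f ∷ᵈ r₂
      , subst (Spells d (suc n) (e ∷ᵈ r₁)) eqL (spells-lift sp₁ (w-block-prefix-a T e<))
      , subst (Spells d (suc n) (f ∷ᵈ r₂)) eqR (spells-lift (subst (Spells d′ n r₂) TM sp₂) tail)
      , suc m , zs′
    where
      zs′ : ∀ i → i ≢ suc m → z d (suc n) (e ∷ᵈ r₁) i ≡ z d (suc n) (f ∷ᵈ r₂) i
      zs′ zero    _  = z-complement D e f ef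
      zs′ (suc i) ne = zs i (λ i≡m → ne (cong suc i≡m))

  reps-firstB-short : ∀ {j v t t₂} → j ≤ D → suc (j + v) ≡ L → (∀ k → k < j → W (p + k) ≡ a) → W (p + v) ≡ b →
                      W′ t ≡ a → start t + D ≡ p + j → W′ t₂ ≡ a → start t₂ + D ≡ p + v → PalindromicReps d p (p + L)
  reps-firstB-short {j} {v} {t} {t₂} j≤D jv before wbv wa eq wa₂ eq₂ =
      reps-via-blocks (m≤n⇒m≤1+n t≤t₂) (m∸n+n≡m j≤D) (<-blockLen-a wa (m∸n≤m D j)) eqL eqR
        (palindromeAt-suffix-a {W = W} pal ≤-refl j<L before eqR)
    where
      open ≡-Reasoning
      j<L : j < L
      j<L = subst (j <_) jv (s≤s (m≤m+n j v))
      j≤v : j ≤ v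
      j≤v = ≮⇒≥ (λ v<j → a≢b (trans (sym (before v v<j)) wbv))
      t≤t₂ : t ≤ t₂
      t≤t₂ = start-cancel-≤ (+-cancelʳ-≤ D (start t) (start t₂) (subst₂ _≤_ (sym eq) (sym eq₂) (+-monoʳ-≤ p j≤v)))
      eqL : start t + (D ∸ j) ≡ p
      eqL = +-cancelʳ-≡ j _ _ (trans (+-assoc (start t) (D ∸ j) j) (trans (cong (start t +_) (m∸n+n≡m j≤D)) eq))
      shuffle₁ : ∀ x D j → x + suc D + j ≡ x + D + suc j
      shuffle₁ = solve-∀
      shuffle₂ : ∀ p v j → p + v + suc j ≡ p + suc (j + v)
      shuffle₂ = solve-∀
      eqR : start (suc t₂) + j ≡ p + L
      eqR = begin
        start (suc t₂) + j    ≡⟨ cong (_+ j) (start-suc-a wa₂) ⟩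
        start t₂ + suc D + j  ≡⟨ shuffle₁ (start t₂) D j ⟩
        start t₂ + D + suc j  ≡⟨ cong (_+ suc j) eq₂ ⟩
        p + v + suc j         ≡⟨ shuffle₂ p v j ⟩
        p + suc (j + v)       ≡⟨ cong (p +_) jv ⟩
        p + L                 ∎

  mirror-of-start-block : ∀ {j v t} → 0 < j → suc (j + v) ≡ L → (∀ k → k < j → W (p + k) ≡ a) →
                          start t + D ≡ p + (j + v) → W′ t ≡ b
  mirror-of-start-block {j} {v} {t} 0<j jv before end with W′ t in wt
  ... | b = refl
  ... | a = ⊥-elim (a≢b (begin
      a                ≡⟨ sym (before 0 0<j) ⟩
      W (p + 0)        ≡⟨ sym (pal (j + v) 0 (trans (cong suc (+-identityʳ (j + v))) jv)) ⟩
      W (p + (j + v))  ≡⟨ cong W (sym end) ⟩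
      W (start t + D)  ≡⟨ w-aBlock-b wt ⟩
      b                ∎))
    where open ≡-Reasoning

  -- More than d₀ leading a's force p to start a b-block, and the first b then comes at offset d₀ + 1.
  reps-firstB-long : ∀ {j v t₂} → D < j → suc (j + v) ≡ L → (∀ k → k < j → W (p + k) ≡ a) →
                     W′ t₂ ≡ a → start t₂ + D ≡ p + v → PalindromicReps d p (p + L)
  reps-firstB-long {j} {v} {t₂} D<j jv before wa₂ eq₂ with aRun-start (λ k k≤D → before k (≤-<-trans k≤D D<j))
  ... | t₀ , wb₀ , start≡p = reps-via-blocks t₀≤ refl (blockLen-pos _) (trans (+-identityʳ _) start≡p) eqR
                               (palindromeAt-suffix-a {W = W} pal (<⇒≤ D<j) j<L before eqR)
    where
      open ≡-Reasoning
      j<L : j < L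
      j<L = subst (j <_) jv (s≤s (m≤m+n j v))
      j≡ : j ≡ suc D
      j≡ = ≤-antisym (≮⇒≥ λ sD<j → a≢b (trans (sym (before (suc D) sD<j))
                        (trans (cong (λ i → W (i + suc D)) (sym start≡p)) (w-bBlock-run-end wb₀)))) D<j
      shuffle₁ : ∀ x D → x + suc D + D ≡ x + D + suc D
      shuffle₁ = solve-∀
      end₂ : start (suc t₂) + D ≡ p + (j + v)
      end₂ = begin
        start (suc t₂) + D     ≡⟨ cong (_+ D) (start-suc-a wa₂) ⟩
        start t₂ + suc D + D   ≡⟨ shuffle₁ (start t₂) D ⟩
        start t₂ + D + suc D   ≡⟨ cong₂ _+_ eq₂ (sym j≡) ⟩
        p + v + j              ≡⟨ trans (+-assoc p v j) (cong (p +_) (+-comm v j)) ⟩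
        p + (j + v)            ∎
      wb₂ : W′ (suc t₂) ≡ b
      wb₂ = mirror-of-start-block (≤-<-trans z≤n D<j) jv before end₂
      t₀≤ : t₀ ≤ suc (suc t₂)
      t₀≤ = m≤n⇒m≤1+n (<⇒≤ (start-cancel-< (≤-<-trans
              (subst (_≤ start t₂ + D) (sym start≡p) (subst (p ≤_) (sym eq₂) (m≤m+n p v)))
              (subst (start t₂ + D <_) (sym (start-suc-a wa₂)) (+-monoʳ-< (start t₂) (n<1+n D))))))
      shuffle₂ : ∀ x D → x + suc D + 1 + D ≡ x + D + suc (suc D)
      shuffle₂ = solve-∀
      shuffle₃ : ∀ p v j → p + v + suc j ≡ p + suc (j + v)
      shuffle₃ = solve-∀
      eqR : start (suc (suc t₂)) + D ≡ p + L
      eqR = begin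
        start (suc (suc t₂)) + D       ≡⟨ cong (_+ D) (trans (start-suc-b wb₂) (cong (_+ 1) (start-suc-a wa₂))) ⟩
        start t₂ + suc D + 1 + D       ≡⟨ shuffle₂ (start t₂) D ⟩
        start t₂ + D + suc (suc D)     ≡⟨ cong₂ (λ x y → x + suc y) eq₂ (sym j≡) ⟩
        p + v + suc j                  ≡⟨ shuffle₃ p v j ⟩
        p + suc (j + v)                ≡⟨ cong (p +_) jv ⟩
        p + L                          ∎

  reps-firstB : ∀ {j} → j < L → W (p + j) ≡ b → (∀ k → k < j → W (p + k) ≡ a) → PalindromicReps d p (p + L)
  reps-firstB {j} j<L wb before with m≤n⇒∃[o]m+o≡n j<L
  ... | v , jv with b-position wb | b-position (trans (sym (pal j v jv)) wb) | j ≤? D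
  ... | t , wa , eq | t₂ , wa₂ , eq₂ | yes j≤D = reps-firstB-short j≤D jv before (trans (sym (pal j v jv)) wb) wa eq wa₂ eq₂
  ... | _           | t₂ , wa₂ , eq₂ | no  j≰D = reps-firstB-long (≰⇒> j≰D) jv before wa₂ eq₂

  reps : PalindromicReps d p (p + L)
  reps with allA-or-firstB W p L
  ... | inj₁ allA                    = reps-allA allA
  ... | inj₂ (j , j<L , wb , before) = reps-firstB j<L wb before

palindromicReps : ∀ N d → Positive d → ∀ p L → p + L ≡ N → PalindromeAt (w d) p L → PalindromicReps d p (p + L)
palindromicReps = <-rec Goal λ N rec d pos p L p+L≡N pal →
  Step.reps d pos pal (λ {T} {M} lt → rec (subst (T + M <_) p+L≡N lt) (shift d) (λ i → pos (suc i)) T M refl)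
  where
    Goal : ℕ → Set
    Goal N = ∀ d → Positive d → ∀ p L → p + L ≡ N → PalindromeAt (w d) p L → PalindromicReps d p (p + L)

mainTheorem4 : (d : ℕ → ℕ) → (∀ i → 1 ≤ d i) →
    (p₁ p₂ : ℕ) → p₁ ≤ p₂ → IsPalindrome (factor d p₁ p₂) →
    Σ ℕ (λ n → Σ (Fin (suc n) → ℕ) (λ r₁ → Σ (Fin (suc n) → ℕ) (λ r₂ →
      ValidRep d n r₁ p₁ × ValidRep d n r₂ p₂ ×
      ∃ (λ (m : Fin (suc n)) → ∀ (i : Fin (suc n)) → i ≢ m → z d n r₁ i ≡ z d n r₂ i))))
mainTheorem4 d pos p₁ p₂ p₁≤p₂ pal
  with palindromicReps _ d pos p₁ (p₂ ∸ p₁) refl (factor-palindromeAt d p₁ p₂ pal)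
... | n , r₁ , r₂ , sp₁ , sp₂ , m , zs =
  n , r₁ , r₂ , spells⇒validRep d n r₁ p₁ sp₁ , spells⇒validRep d n r₂ p₂ (subst (Spells d n r₂) (m+[n∸m]≡n p₁≤p₂) sp₂) , m , zs
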